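{- Let $T_1$ and $T_2$ be subtrees of a tree $T$ such that $T=T_1\cup T_2$. Then $\operatorname{pw}(T)+1\le(\operatorname{pw}(T_1)+1)+(\operatorname{pw}(T_2)+1)$.
   Context: $\operatorname{pw}$ denotes pathwidth: the minimum, over path decompositions (sequences of vertex subsets such that every edge lies in some bag and each vertex's bags form a non-empty consecutive interval), of the maximum bag size minus 1. Subtrees are connected subgraphs of $T$. -}

module Defs where

open import Data.Nat using (ℕ; suc; _≤_)
open import Data.Fin using (Fin)
open import Data.Fin.Subset using (Subset; _∈_; ∣_∣)
open import Data.List using (List; []; _∷_; _∷ʳ_; length)
open import Data.List.Relation.Unary.Linked using (Linked)
open import Data.List.Relation.Unary.Unique.Propositional using (Unique)
open import Data.Product using (Σ; ∃; _×_)
open import Data.Sum using (_⊎_)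
open import Relation.Binary.PropositionalEquality using (_≡_)
open import Relation.Nullary using (¬_)

record Gr (n : ℕ) : Set₁ where
  field
    V : Fin n → Set
    E : Fin n → Fin n → Set
open Gr public

record WellFormed {n : ℕ} (G : Gr n) : Set where
  field
    sym   : ∀ u v → E G u v → E G v u
    irr   : ∀ v → ¬ E G v v
    endsV : ∀ u v → E G u v → V G u × V G v

data Walk {n : ℕ} (G : Gr n) : Fin n → Fin n → Set where
  here : ∀ {v} → V G v → Walk G v v
  step : ∀ {u w v} → E G u w → Walk G w v → Walk G u v

Connected : {n : ℕ} → Gr n → Set
Connected G = (∃ λ v → V G v) × (∀ u v → V G u → V G v → Walk G u v)

Cycle : {n : ℕ} → Gr n → Set
Cycle {n} G = Σ (Fin n) λ x → Σ (List (Fin n)) λ ys →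
  (2 ≤ length ys) × Unique (x ∷ ys) × Linked (E G) ((x ∷ ys) ∷ʳ x)

Acyclic : {n : ℕ} → Gr n → Set
Acyclic G = ¬ Cycle G

IsTree : {n : ℕ} → Gr n → Set
IsTree G = WellFormed G × Connected G × Acyclic G

_⊑_ : {n : ℕ} → Gr n → Gr n → Set
H ⊑ G = (∀ v → V H v → V G v) × (∀ u v → E H u v → E G u v)

IsSubtree : {n : ℕ} → Gr n → Gr n → Set
IsSubtree H T = WellFormed H × H ⊑ T × Connected H

-- G = G₁ ∪ G₂ (given G₁, G₂ ⊑ G, this is the remaining inclusion).
CoveredBy : {n : ℕ} → Gr n → Gr n → Gr n → Set
CoveredBy G G₁ G₂ = (∀ v → V G v → V G₁ v ⊎ V G₂ v)
                  × (∀ u v → E G u v → E G₁ u v ⊎ E G₂ u v)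

record PathDecomposition {n : ℕ} (G : Gr n) : Set where
  field
    len      : ℕ
    bag      : Fin len → Subset n
    bagsInV  : ∀ i v → v ∈ bag i → V G v
    edgeCov  : ∀ u v → E G u v → ∃ λ i → (u ∈ bag i) × (v ∈ bag i)
    vertCov  : ∀ v → V G v → ∃ λ i → v ∈ bag i
    interval : ∀ v (i j k : Fin len) → Data.Fin._≤_ i j → Data.Fin._≤_ j k →
               v ∈ bag i → v ∈ bag k → v ∈ bag j
open PathDecomposition public

HasPDWidth≤ : {n : ℕ} → Gr n → ℕ → Set
HasPDWidth≤ G k = Σ (PathDecomposition G) λ D → ∀ i → ∣ bag D i ∣ ≤ suc k

IsPathwidth : {n : ℕ} → Gr n → ℕ → Set
IsPathwidth G p = HasPDWidth≤ G p × (∀ k → HasPDWidth≤ G k → p ≤ k)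

-- Let (Aᵢ) and (Bⱼ) be path decompositions of T₁ and T₂. Since T is a tree and T₁ is connected,
-- every vertex v of T outside T₁ is reached from T₁ through a unique attachment vertex, and
-- adjacent vertices outside T₁ have the same one. Fix for each such v a bag index a(v) of (Aᵢ)
-- containing its attachment vertex, and order the bags  Aᵢ ∪ {v ∈ Bⱼ ∖ V(T₁) : a(v) = i}
-- lexicographically in (i, j): a copy of (Bⱼ), restricted to the vertices anchored at i, is
-- inserted after each Aᵢ. This is a path decomposition of T with bags of size ≤ |Aᵢ| + |Bⱼ|.

module Submission where

open import Defs
open import Data.Nat using (ℕ; suc; _+_; _*_; _≤_; z≤n; s≤s)
open import Data.Nat.Properties as ℕ using (+-monoˡ-≤; +-mono-≤; ≤-trans)
open import Data.Nat.Tactic.RingSolver using (solve-∀)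
open import Data.Fin as Fin using (Fin; combine; remQuot; toℕ)
open import Data.Fin.Properties as Fin using (_≟_; any?)
open import Data.Fin.Subset using (Subset; _∈_; ∣_∣; _∪_; _∩_; inside; outside; _⊆_)
open import Data.Fin.Subset.Properties as Subset using (_∈?_; p⊆q⇒∣p∣≤∣q∣)
open import Data.Vec using ([]; _∷_; tabulate)
open import Data.Vec.Properties using (lookup∘tabulate; lookup⇒[]=; []=⇒lookup)
open import Data.Bool.Properties using (T-≡)
open import Data.List using (List; []; _∷_; _∷ʳ_; length)
open import Data.List.Relation.Unary.All as All using (All; []; _∷_)
open import Data.List.Relation.Unary.All.Properties using (¬Any⇒All¬)
open import Data.List.Relation.Unary.Any using (here; there)
open import Data.List.Membership.Propositional using () renaming (_∈_ to _∈ˡ_; _∉_ to _∉ˡ_)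
import Data.List.Membership.DecPropositional as DecMembership
open import Data.List.Relation.Unary.Unique.Propositional using (Unique)
open import Data.List.Relation.Unary.AllPairs using ([]; _∷_)
open import Data.List.Relation.Unary.Linked using (Linked; [-]; _∷_)
open import Data.Product using (Σ; ∃; _×_; _,_; proj₁; proj₂)
open import Data.Sum using (_⊎_; inj₁; inj₂; [_,_]′; map₁; map₂)
open import Data.Empty using (⊥-elim)
open import Function using (_∘_; Equivalence)
open import Relation.Nullary using (¬_; yes; no; ¬?; _×-dec_)
open import Relation.Nullary.Decidable using (map′; isYes; fromWitness; toWitness)
open import Relation.Unary using (Decidable)
open import Relation.Binary.PropositionalEquality using (_≡_; _≢_; refl; sym; trans; cong; subst; subst₂)

∣p∪q∣≤∣p∣+∣q∣ : ∀ {n} (p q : Subset n) → ∣ p ∪ q ∣ ≤ ∣ p ∣ + ∣ q ∣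
∣p∪q∣≤∣p∣+∣q∣ []            []            = z≤n
∣p∪q∣≤∣p∣+∣q∣ (inside ∷ p)  (inside ∷ q)  =
  s≤s (≤-trans (ℕ.m≤n⇒m≤1+n (∣p∪q∣≤∣p∣+∣q∣ p q)) (ℕ.≤-reflexive (sym (ℕ.+-suc _ _))))
∣p∪q∣≤∣p∣+∣q∣ (inside ∷ p)  (outside ∷ q) = s≤s (∣p∪q∣≤∣p∣+∣q∣ p q)
∣p∪q∣≤∣p∣+∣q∣ (outside ∷ p) (inside ∷ q)  =
  ≤-trans (s≤s (∣p∪q∣≤∣p∣+∣q∣ p q)) (ℕ.≤-reflexive (sym (ℕ.+-suc _ _)))
∣p∪q∣≤∣p∣+∣q∣ (outside ∷ p) (outside ∷ q) = ∣p∪q∣≤∣p∣+∣q∣ p q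

module _ {n : ℕ} {P : Fin n → Set} (P? : Decidable P) where

  select : Subset n
  select = tabulate (isYes ∘ P?)

  ∈-select⁺ : ∀ {x} → P x → x ∈ select
  ∈-select⁺ {x} px = lookup⇒[]= x select
    (trans (lookup∘tabulate _ x) (Equivalence.to T-≡ (fromWitness px)))

  ∈-select⁻ : ∀ {x} → x ∈ select → P x
  ∈-select⁻ {x} x∈ = toWitness (Equivalence.from T-≡
    (trans (sym (lookup∘tabulate _ x)) ([]=⇒lookup x∈)))

module QuotRem (m n : ℕ) where

  quot : Fin (m * n) → Fin m
  quot k = proj₁ (remQuot {m} n k)

  rem : Fin (m * n) → Fin n
  rem k = proj₂ (remQuot {m} n k)

  toℕ-quot-rem : ∀ k → toℕ k ≡ n * toℕ (quot k) + toℕ (rem k)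
  toℕ-quot-rem k = trans (cong toℕ (sym (Fin.combine-remQuot {m} n k))) (Fin.toℕ-combine (quot k) (rem k))

  quot-mono : ∀ {k l} → k Fin.≤ l → quot k Fin.≤ quot l
  quot-mono {k} {l} k≤l = ℕ.≮⇒≥ λ l<k → ℕ.<⇒≱ (subst₂ Fin._<_
    (Fin.combine-remQuot {m} n l) (Fin.combine-remQuot {m} n k)
    (Fin.combine-monoˡ-< (rem l) (rem k) l<k)) k≤l

  rem-mono : ∀ {k l} → k Fin.≤ l → quot k ≡ quot l → rem k Fin.≤ rem l
  rem-mono {k} {l} k≤l eq = ℕ.+-cancelˡ-≤ (n * toℕ (quot k)) (toℕ (rem k)) (toℕ (rem l))
    (subst₂ _≤_ (toℕ-quot-rem k) (trans (toℕ-quot-rem l) (cong (λ i → n * toℕ i + toℕ (rem l)) (sym eq))) k≤l)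

module _ {n : ℕ} {G : Gr n} where

  open DecMembership (_≟_ {n}) using () renaming (_∈?_ to _∈ˡ?_)

  tailVertices : ∀ {x y} → Walk G x y → List (Fin n)
  tailVertices (here _)           = []
  tailVertices (step {w = w} _ p) = w ∷ tailVertices p

  vertices : ∀ {x y} → Walk G x y → List (Fin n)
  vertices {x} p = x ∷ tailVertices p

  initVertices : ∀ {x y} → Walk G x y → List (Fin n)
  initVertices (here _)       = []
  initVertices (step {u} _ p) = u ∷ initVertices p

  infixr 5 _++ʷ_
  _++ʷ_ : ∀ {x y z} → Walk G x y → Walk G y z → Walk G x z
  here _   ++ʷ q = q
  step e p ++ʷ q = step e (p ++ʷ q)

  ∈-vertices-++ʷ⁻ : ∀ {x y z t} (p : Walk G x y) (q : Walk G y z) →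
                    t ∈ˡ vertices (p ++ʷ q) → t ∈ˡ vertices p ⊎ t ∈ˡ vertices q
  ∈-vertices-++ʷ⁻ (here _)   q t∈         = inj₂ t∈
  ∈-vertices-++ʷ⁻ (step e p) q (here eq)  = inj₁ (here eq)
  ∈-vertices-++ʷ⁻ (step e p) q (there t∈) = map₁ there (∈-vertices-++ʷ⁻ p q t∈)

  All-vertices-++ʷ : ∀ {P : Fin n → Set} {x y z} (p : Walk G x y) (q : Walk G y z) →
                     All P (vertices p) → All P (vertices q) → All P (vertices (p ++ʷ q))
  All-vertices-++ʷ (here _)   q _         Pq = Pq
  All-vertices-++ʷ (step e p) q (Px ∷ Pp) Pq = Px ∷ All-vertices-++ʷ p q Pp Pq

  All-initVertices : ∀ {P : Fin n → Set} {x y} (p : Walk G x y) → All P (vertices p) → All P (initVertices p)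
  All-initVertices (here _)   _         = []
  All-initVertices (step e p) (Px ∷ Pp) = Px ∷ All-initVertices p Pp

  end∈vertices : ∀ {x y} (p : Walk G x y) → y ∈ˡ vertices p
  end∈vertices (here _)   = here refl
  end∈vertices (step e p) = there (end∈vertices p)

  Unique⇒initVertices≢end : ∀ {x y} (p : Walk G x y) → Unique (vertices p) → All (_≢ y) (initVertices p)
  Unique⇒initVertices≢end (here _)   _           = []
  Unique⇒initVertices≢end (step e p) (x∉ ∷ uniq) =
    All.lookup x∉ (end∈vertices p) ∷ Unique⇒initVertices≢end p uniq

  Unique-++ʷ : ∀ {x y z} (p : Walk G x y) (q : Walk G y z) → Unique (vertices p) → Unique (vertices q) →
               All (_∉ˡ vertices q) (initVertices p) → Unique (vertices (p ++ʷ q))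
  Unique-++ʷ (here _)   q _          uq _            = uq
  Unique-++ʷ (step e p) q (x∉p ∷ up) uq (x∉q ∷ disj) =
    All.tabulate (λ t∈ → [ All.lookup x∉p , (λ t∈q x≡t → x∉q (subst (_∈ˡ vertices q) (sym x≡t) t∈q)) ]′
                           (∈-vertices-++ʷ⁻ p q t∈))
    ∷ Unique-++ʷ p q up uq disj

  2≤length-vertices : ∀ {x y z w} (p : Walk G x y) (e : E G y z) (q : Walk G z w) →
                      2 ≤ length (vertices (p ++ʷ step e q))
  2≤length-vertices (here _)   e q = s≤s (s≤s z≤n)
  2≤length-vertices (step f p) e q = ℕ.m≤n⇒m≤1+n (2≤length-vertices p e q)

  suffixFrom : ∀ {P : Fin n → Set} {a x y} (q : Walk G a y) → x ∈ˡ vertices q → Unique (vertices q) →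
               All P (vertices q) → Σ (Walk G x y) λ r → Unique (vertices r) × All P (vertices r)
  suffixFrom q          (here refl) uq       Pq       = q , uq , Pq
  suffixFrom (step e q) (there x∈)  (_ ∷ uq) (_ ∷ Pq) = suffixFrom q x∈ uq Pq

  toPath : ∀ {P : Fin n → Set} {x y} (p : Walk G x y) → All P (vertices p) →
           Σ (Walk G x y) λ q → Unique (vertices q) × All P (vertices q)
  toPath (here v) Px = here v , [] ∷ [] , Px
  toPath {x = x} (step e p) (Px ∷ Pp) with toPath p Pp
  ... | q , uq , Pq with x ∈ˡ? vertices q
  ...   | yes x∈ = suffixFrom q x∈ uq Pq
  ...   | no x∉  = step e q , ¬Any⇒All¬ (vertices q) x∉ ∷ uq , Px ∷ Pq

  close-path : ∀ {x y} (p : Walk G x y) → Unique (vertices p) → E G y x → 2 ≤ length (tailVertices p) → Cycle G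
  close-path {x} p up e 2≤ = x , tailVertices p , 2≤ , up , linked p e
    where
      linked : ∀ {x y z} (p : Walk G x y) → E G y z → Linked (E G) (vertices p ∷ʳ z)
      linked (here _)   e = e ∷ [-]
      linked (step f p) e = f ∷ linked p e

  module WellFormedWalks (wf : WellFormed G) where
    open WellFormed wf using (endsV) renaming (sym to edge-sym)

    infixl 5 _▷_
    _▷_ : ∀ {x y z} → Walk G x y → E G y z → Walk G x z
    here _   ▷ e = step e (here (proj₂ (endsV _ _ e)))
    step f p ▷ e = step f (p ▷ e)

    All-vertices-▷ : ∀ {P : Fin n → Set} {x y z} (p : Walk G x y) (e : E G y z) →
                     All P (vertices p) → P z → All P (vertices (p ▷ e))
    All-vertices-▷ (here _)   e (Py ∷ []) Pz = Py ∷ Pz ∷ []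
    All-vertices-▷ (step f p) e (Px ∷ Pp) Pz = Px ∷ All-vertices-▷ p e Pp Pz

    All-tailVertices-▷ : ∀ {P : Fin n → Set} {x y z} (p : Walk G x y) (e : E G y z) →
                         All P (tailVertices p) → P z → All P (tailVertices (p ▷ e))
    All-tailVertices-▷ (here _)   e _  Pz = Pz ∷ []
    All-tailVertices-▷ (step f p) e Pp Pz = All-vertices-▷ p e Pp Pz

    reverse : ∀ {x y} → Walk G x y → Walk G y x
    reverse (here v)   = here v
    reverse (step e p) = reverse p ▷ edge-sym _ _ e

    All-vertices-reverse : ∀ {P : Fin n → Set} {x y} (p : Walk G x y) →
                           All P (vertices p) → All P (vertices (reverse p))
    All-vertices-reverse (here _)   Pp        = Pp
    All-vertices-reverse (step e p) (Px ∷ Pp) = All-vertices-▷ (reverse p) _ (All-vertices-reverse p Pp) Px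

    All-V-vertices : ∀ {x y} (p : Walk G x y) → All (V G) (vertices p)
    All-V-vertices (here v)   = v ∷ []
    All-V-vertices (step e p) = proj₁ (endsV _ _ e) ∷ All-V-vertices p

module _ {n : ℕ} {H G : Gr n} (H⊑G : H ⊑ G) where

  mapWalk : ∀ {x y} → Walk H x y → Walk G x y
  mapWalk (here v)   = here (proj₁ H⊑G _ v)
  mapWalk (step e p) = step (proj₂ H⊑G _ _ e) (mapWalk p)

  vertices-mapWalk : ∀ {x y} (p : Walk H x y) → vertices (mapWalk p) ≡ vertices p
  vertices-mapWalk (here _)       = refl
  vertices-mapWalk (step {u} e p) = cong (u ∷_) (vertices-mapWalk p)

vertex? : ∀ {n} {G : Gr n} → PathDecomposition G → Decidable (V G)
vertex? D v = map′ (λ (i , v∈) → bagsInV D i v v∈) (vertCov D v) (any? λ i → v ∈? bag D i)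

module Glue {n : ℕ} {G G₁ G₂ : Gr n} (wf : WellFormed G) (G₁⊑G : G₁ ⊑ G) (G₂⊑G : G₂ ⊑ G)
            (cover : CoveredBy G G₁ G₂) (D₁ : PathDecomposition G₁) (D₂ : PathDecomposition G₂)
            (j₀ : Fin (len D₂)) (anchor : Fin n → Fin (len D₁))
            (edge₁ : ∀ {u v} → E G u v → V G₁ u → V G₁ v → E G₁ u v)
            (anchor-edge : ∀ {u v} → E G u v → ¬ V G₁ u → ¬ V G₁ v → anchor u ≡ anchor v)
            (anchor-bag : ∀ {u v} → E G u v → V G₁ u → ¬ V G₁ v → u ∈ bag D₁ (anchor v)) where

  open QuotRem (len D₁) (len D₂)

  private
    A = bag D₁
    B = bag D₂

  hanging : Fin (len D₁) → Subset n
  hanging i = select (λ v → ¬? (vertex? D₁ v) ×-dec (anchor v ≟ i))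

  mergedBag : Fin (len D₁) → Fin (len D₂) → Subset n
  mergedBag i j = A i ∪ (B j ∩ hanging i)

  module _ {v : Fin n} {i : Fin (len D₁)} {j : Fin (len D₂)} where

    ∈-mergedBag⁺ˡ : v ∈ A i → v ∈ mergedBag i j
    ∈-mergedBag⁺ˡ v∈ = Subset.x∈p∪q⁺ (inj₁ v∈)

    ∈-mergedBag⁺ʳ : v ∈ B j → ¬ V G₁ v → anchor v ≡ i → v ∈ mergedBag i j
    ∈-mergedBag⁺ʳ v∈ v∉ eq = Subset.x∈p∪q⁺ (inj₂ (Subset.x∈p∩q⁺ (v∈ , ∈-select⁺ _ (v∉ , eq))))

    ∈-mergedBag⁻ : v ∈ mergedBag i j → v ∈ A i ⊎ (v ∈ B j × ¬ V G₁ v × anchor v ≡ i)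
    ∈-mergedBag⁻ v∈ with Subset.x∈p∪q⁻ (A i) (B j ∩ hanging i) v∈
    ... | inj₁ v∈A = inj₁ v∈A
    ... | inj₂ v∈B∩ with Subset.x∈p∩q⁻ (B j) (hanging i) v∈B∩
    ...   | v∈B , v∈hanging = inj₂ (v∈B , ∈-select⁻ _ v∈hanging)

    ∈-mergedBag⁻-inside : V G₁ v → v ∈ mergedBag i j → v ∈ A i
    ∈-mergedBag⁻-inside v₁ v∈ with ∈-mergedBag⁻ v∈
    ... | inj₁ v∈A            = v∈A
    ... | inj₂ (_ , v∉ , _) = ⊥-elim (v∉ v₁)

    ∈-mergedBag⁻-outside : ¬ V G₁ v → v ∈ mergedBag i j → v ∈ B j × anchor v ≡ i
    ∈-mergedBag⁻-outside v∉ v∈ with ∈-mergedBag⁻ v∈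
    ... | inj₁ v∈A            = ⊥-elim (v∉ (bagsInV D₁ i v v∈A))
    ... | inj₂ (v∈B , _ , eq) = v∈B , eq

  mergedBag-size : ∀ i j → ∣ mergedBag i j ∣ ≤ ∣ A i ∣ + ∣ B j ∣
  mergedBag-size i j = ≤-trans (p⊆q⇒∣p∣≤∣q∣ merged⊆A∪B) (∣p∪q∣≤∣p∣+∣q∣ (A i) (B j))
    where
      merged⊆A∪B : mergedBag i j ⊆ A i ∪ B j
      merged⊆A∪B v∈ = Subset.x∈p∪q⁺ (map₂ proj₁ (∈-mergedBag⁻ v∈))

  glued-bag : Fin (len D₁ * len D₂) → Subset n
  glued-bag k = mergedBag (quot k) (rem k)

  ∈-glued-bag : ∀ {v i j} → v ∈ mergedBag i j → v ∈ glued-bag (combine i j)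
  ∈-glued-bag {v} {i} {j} = subst (λ (i , j) → v ∈ mergedBag i j) (sym (Fin.remQuot-combine i j))

  CommonBag : Fin n → Fin n → Set
  CommonBag u v = ∃ λ i → ∃ λ j → u ∈ mergedBag i j × v ∈ mergedBag i j

  edge-common : ∀ u v → E G u v → CommonBag u v
  edge-common u v e with proj₂ cover u v e
  ... | inj₁ e₁ with edgeCov D₁ u v e₁
  ...   | i , u∈ , v∈ = i , j₀ , ∈-mergedBag⁺ˡ u∈ , ∈-mergedBag⁺ˡ v∈
  edge-common u v e | inj₂ e₂ with edgeCov D₂ u v e₂ | vertex? D₁ u | vertex? D₁ v
  ... | j , u∈ , v∈ | yes u₁ | yes v₁ with edgeCov D₁ u v (edge₁ e u₁ v₁)
  ...   | i , u∈′ , v∈′ = i , j , ∈-mergedBag⁺ˡ u∈′ , ∈-mergedBag⁺ˡ v∈′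
  edge-common u v e | inj₂ e₂ | j , u∈ , v∈ | yes u₁ | no v∉ =
    anchor v , j , ∈-mergedBag⁺ˡ (anchor-bag e u₁ v∉) , ∈-mergedBag⁺ʳ v∈ v∉ refl
  edge-common u v e | inj₂ e₂ | j , u∈ , v∈ | no u∉ | yes v₁ =
    anchor u , j , ∈-mergedBag⁺ʳ u∈ u∉ refl , ∈-mergedBag⁺ˡ (anchor-bag (WellFormed.sym wf u v e) v₁ u∉)
  edge-common u v e | inj₂ e₂ | j , u∈ , v∈ | no u∉ | no v∉ =
    anchor u , j , ∈-mergedBag⁺ʳ u∈ u∉ refl , ∈-mergedBag⁺ʳ v∈ v∉ (sym (anchor-edge e u∉ v∉))

  vertex-bag : ∀ v → V G v → ∃ λ i → ∃ λ j → v ∈ mergedBag i j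
  vertex-bag v v∈G with vertex? D₁ v | proj₁ cover v v∈G
  ... | yes v₁ | _      = proj₁ (vertCov D₁ v v₁) , j₀ , ∈-mergedBag⁺ˡ (proj₂ (vertCov D₁ v v₁))
  ... | no v∉  | inj₁ v₁ = ⊥-elim (v∉ v₁)
  ... | no v∉  | inj₂ v₂ = anchor v , proj₁ (vertCov D₂ v v₂) , ∈-mergedBag⁺ʳ (proj₂ (vertCov D₂ v v₂)) v∉ refl

  glued-interval : ∀ v (k₁ k₂ k₃ : Fin (len D₁ * len D₂)) → k₁ Fin.≤ k₂ → k₂ Fin.≤ k₃ →
                   v ∈ glued-bag k₁ → v ∈ glued-bag k₃ → v ∈ glued-bag k₂
  glued-interval v k₁ k₂ k₃ k₁≤k₂ k₂≤k₃ v∈₁ v∈₃ with vertex? D₁ v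
  ... | yes v₁ = ∈-mergedBag⁺ˡ
    (interval D₁ v (quot k₁) (quot k₂) (quot k₃) (quot-mono k₁≤k₂) (quot-mono k₂≤k₃)
                   (∈-mergedBag⁻-inside v₁ v∈₁) (∈-mergedBag⁻-inside v₁ v∈₃))
  ... | no v∉ = ∈-mergedBag⁺ʳ
    (interval D₂ v (rem k₁) (rem k₂) (rem k₃) (rem-mono k₁≤k₂ q₁≡q₂) (rem-mono k₂≤k₃ q₂≡q₃)
                   (proj₁ out₁) (proj₁ out₃))
    v∉ (trans (proj₂ out₁) q₁≡q₂)
    where
      out₁ = ∈-mergedBag⁻-outside v∉ v∈₁
      out₃ = ∈-mergedBag⁻-outside v∉ v∈₃
      q₁≡q₃ : quot k₁ ≡ quot k₃
      q₁≡q₃ = trans (sym (proj₂ out₁)) (proj₂ out₃)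
      -- quot k₂ is squeezed between quot k₁ and quot k₃, which are both the anchor of v
      q₁≡q₂ : quot k₁ ≡ quot k₂
      q₁≡q₂ = Fin.≤-antisym (quot-mono k₁≤k₂) (subst (quot k₂ Fin.≤_) (sym q₁≡q₃) (quot-mono k₂≤k₃))
      q₂≡q₃ : quot k₂ ≡ quot k₃
      q₂≡q₃ = trans (sym q₁≡q₂) q₁≡q₃

  glued : PathDecomposition G
  glued = record
    { len      = len D₁ * len D₂
    ; bag      = glued-bag
    ; bagsInV  = λ k v v∈ → [ (λ v∈A → proj₁ G₁⊑G v (bagsInV D₁ _ v v∈A))
                            , (λ (v∈B , _) → proj₁ G₂⊑G v (bagsInV D₂ _ v v∈B)) ]′ (∈-mergedBag⁻ v∈)
    ; edgeCov  = λ u v e → let (i , j , u∈ , v∈) = edge-common u v e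
                           in combine i j , ∈-glued-bag u∈ , ∈-glued-bag v∈
    ; vertCov  = λ v v∈G → let (i , j , v∈) = vertex-bag v v∈G in combine i j , ∈-glued-bag v∈
    ; interval = glued-interval
    }

  glued-width : ∀ {p₁ p₂} → (∀ i → ∣ A i ∣ ≤ suc p₁) → (∀ j → ∣ B j ∣ ≤ suc p₂) → HasPDWidth≤ G (p₁ + suc p₂)
  glued-width w₁ w₂ = glued , λ k → ≤-trans (mergedBag-size (quot k) (rem k)) (+-mono-≤ (w₁ (quot k)) (w₂ (rem k)))

module Attachment {n : ℕ} {T H : Gr n} (tree : IsTree T) (subtree : IsSubtree H T) (H? : Decidable (V H)) where

  private
    wf         = proj₁ tree
    connected  = proj₁ (proj₂ tree)
    acyclic    = proj₂ (proj₂ tree)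
    wfH        = proj₁ subtree
    H⊑T        = proj₁ (proj₂ subtree)
    connectedH = proj₂ (proj₂ subtree)
    w          = proj₁ (proj₁ connectedH)
    w∈         = proj₂ (proj₁ connectedH)

  open WellFormedWalks wf

  AttachedAt : Fin n → Fin n → Set
  AttachedAt v u = V H u × Σ (Walk T u v) λ p → All (¬_ ∘ V H) (tailVertices p)

  H-path : ∀ {u v} → V H u → V H v →
           Σ (Walk H u v) λ r → Unique (vertices (mapWalk H⊑T r)) × All (V H) (vertices (mapWalk H⊑T r))
  H-path u∈ v∈ with toPath (proj₂ connectedH _ _ u∈ v∈) (WellFormedWalks.All-V-vertices wfH _)
  ... | r , ur , Hr = r , subst Unique (sym (vertices-mapWalk H⊑T r)) ur
                        , subst (All (V H)) (sym (vertices-mapWalk H⊑T r)) Hr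

  subtree-edge : ∀ {u v} → E T u v → V H u → V H v → E H u v
  subtree-edge e u∈ v∈ = along e (proj₁ (H-path u∈ v∈)) (proj₁ (proj₂ (H-path u∈ v∈)))
    where
      along : ∀ {u v} → E T u v → (r : Walk H u v) → Unique (vertices (mapWalk H⊑T r)) → E H u v
      along e (here _)          _  = ⊥-elim (WellFormed.irr wf _ e)
      along e (step f (here _)) _  = f
      along e r@(step _ (step _ _)) ur =
        ⊥-elim (acyclic (close-path (mapWalk H⊑T r) ur (WellFormed.sym wf _ _ e) (s≤s (s≤s z≤n))))

  lastExit : ∀ {s t} (p : Walk T s t) → ∃ (AttachedAt t) ⊎ All (¬_ ∘ V H) (vertices p)
  lastExit {t = t} (here t∈T) with H? t
  ... | yes t∈ = inj₁ (t , t∈ , here t∈T , [])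
  ... | no t∉  = inj₂ (t∉ ∷ [])
  lastExit {s} (step e p) with lastExit p | H? s
  ... | inj₁ att | _     = inj₁ att
  ... | inj₂ out | yes s∈ = inj₁ (s , s∈ , step e p , out)
  ... | inj₂ out | no s∉  = inj₂ (s∉ ∷ out)

  attached-exists : ∀ {v} → V T v → ∃ (AttachedAt v)
  attached-exists {v} v∈ with lastExit (proj₂ connected w v (proj₁ H⊑T w w∈) v∈)
  ... | inj₁ att      = att
  ... | inj₂ (w∉ ∷ _) = ⊥-elim (w∉ w∈)

  attached-extend : ∀ {u v w} → AttachedAt v u → E T v w → ¬ V H w → AttachedAt w u
  attached-extend (u∈ , p , out) e w∉ = u∈ , p ▷ e , All-tailVertices-▷ p e out w∉

  -- Otherwise p, a path of H back from u₂ to u₁ and the edge u₁x would form a cycle.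
  reenters-at-exit : ∀ {u₁ x u₂} → E T u₁ x → ¬ V H x →
                     (p : Walk T x u₂) → Unique (vertices p) → All (λ z → ¬ V H z ⊎ z ≡ u₂) (vertices p) →
                     (r : Walk T u₂ u₁) → Unique (vertices r) → All (V H) (vertices r) → u₁ ≡ u₂
  reenters-at-exit e x∉ p up Qp (here _) _ _ = refl
  reenters-at-exit e x∉ (here _) _ _ (step _ _) _ (u₂∈ ∷ _) = ⊥-elim (x∉ u₂∈)
  reenters-at-exit e x∉ p@(step _ p′) up Qp r@(step g r′) ur Hr =
    ⊥-elim (acyclic (close-path (p ++ʷ r) (Unique-++ʷ p r up ur disjoint) e (2≤length-vertices p′ g r′)))
    where
      disjoint : All (_∉ˡ vertices r) (initVertices p)
      disjoint = All.zipWith (λ { (inj₁ z∉ , _)  z∈r → z∉ (All.lookup Hr z∈r)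
                                ; (inj₂ z≡ , z≢) _   → z≢ z≡ })
                             (All-initVertices p Qp , Unique⇒initVertices≢end p up)

  attached-unique : ∀ {v u₁ u₂} → ¬ V H v → AttachedAt v u₁ → AttachedAt v u₂ → u₁ ≡ u₂
  attached-unique v∉ (u₁∈ , here _ , _) _ = ⊥-elim (v∉ u₁∈)
  attached-unique v∉ (u₁∈ , step e p , out₁) (u₂∈ , q , out₂) =
    reenters-at-exit e (All.head out₁) p′ up′ Qp′ (mapWalk H⊑T r) ur Hr
    where
      q⁻¹ = reverse q
      outside-until-u₂ = toPath (p ++ʷ q⁻¹)
        (All-vertices-++ʷ p q⁻¹ (All.map inj₁ out₁) (All-vertices-reverse q (inj₂ refl ∷ All.map inj₁ out₂)))
      p′  = proj₁ outside-until-u₂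
      up′ = proj₁ (proj₂ outside-until-u₂)
      Qp′ = proj₂ (proj₂ outside-until-u₂)
      r   = proj₁ (H-path u₂∈ u₁∈)
      ur  = proj₁ (proj₂ (H-path u₂∈ u₁∈))
      Hr  = proj₂ (proj₂ (H-path u₂∈ u₁∈))

module TreeAnchor {n : ℕ} {T T₁ T₂ : Gr n} (tree : IsTree T) (subtree₁ : IsSubtree T₁ T) (T₂⊑T : T₂ ⊑ T)
                  (cover : CoveredBy T T₁ T₂) (D₁ : PathDecomposition T₁) (D₂ : PathDecomposition T₂) where

  open Attachment tree subtree₁ (vertex? D₁)

  private
    i₀ : Fin (len D₁)
    i₀ = proj₁ (vertCov D₁ _ (proj₂ (proj₁ (proj₂ (proj₂ subtree₁)))))

  bagIndex : Fin n → Fin (len D₁)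
  bagIndex u with any? (λ i → u ∈? bag D₁ i)
  ... | yes (i , _) = i
  ... | no _        = i₀

  ∈-bagIndex : ∀ {u} → V T₁ u → u ∈ bag D₁ (bagIndex u)
  ∈-bagIndex {u} u∈ with any? (λ i → u ∈? bag D₁ i)
  ... | yes (_ , u∈bag) = u∈bag
  ... | no none         = ⊥-elim (none (vertCov D₁ u u∈))

  -- Membership in T is not decidable, but every vertex of T outside T₁ lies in T₂.
  anchor : Fin n → Fin (len D₁)
  anchor v with vertex? D₂ v
  ... | yes v₂ = bagIndex (proj₁ (attached-exists (proj₁ T₂⊑T v v₂)))
  ... | no _   = i₀

  anchor-attached : ∀ {u v} → V T v → ¬ V T₁ v → AttachedAt v u → anchor v ≡ bagIndex u
  anchor-attached {v = v} v∈ v∉ att with vertex? D₂ v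
  ... | yes v₂ = cong bagIndex (attached-unique v∉ (proj₂ (attached-exists (proj₁ T₂⊑T v v₂))) att)
  ... | no v∉₂ = ⊥-elim ([ v∉ , v∉₂ ]′ (proj₁ cover v v∈))

  anchor-edge : ∀ {u v} → E T u v → ¬ V T₁ u → ¬ V T₁ v → anchor u ≡ anchor v
  anchor-edge {u} {v} e u∉ v∉ =
    trans (anchor-attached u∈ u∉ (proj₂ att)) (sym (anchor-attached v∈ v∉ (attached-extend (proj₂ att) e v∉)))
    where
      u∈  = proj₁ (WellFormed.endsV (proj₁ tree) u v e)
      v∈  = proj₂ (WellFormed.endsV (proj₁ tree) u v e)
      att = attached-exists u∈

  anchor-bag : ∀ {u v} → E T u v → V T₁ u → ¬ V T₁ v → u ∈ bag D₁ (anchor v)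
  anchor-bag {u} {v} e u₁ v∉ =
    subst (λ i → u ∈ bag D₁ i) (sym (anchor-attached v∈ v∉ (u₁ , step e (here v∈) , v∉ ∷ []))) (∈-bagIndex u₁)
    where
      v∈ = proj₂ (WellFormed.endsV (proj₁ tree) u v e)

lemma7 : {n : ℕ} (T T₁ T₂ : Gr n) → IsTree T → IsSubtree T₁ T → IsSubtree T₂ T →
    CoveredBy T T₁ T₂ → (p p₁ p₂ : ℕ) →
    IsPathwidth T p → IsPathwidth T₁ p₁ → IsPathwidth T₂ p₂ →
    p + 1 ≤ (p₁ + 1) + (p₂ + 1)
lemma7 T T₁ T₂ tree subtree₁ subtree₂ cover p p₁ p₂ (_ , minimal) ((D₁ , w₁) , _) ((D₂ , w₂) , _) =
  subst (p + 1 ≤_) (rearrange p₁ p₂) (+-monoˡ-≤ 1 (minimal (p₁ + suc p₂) (glued-width w₁ w₂)))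
  where
    T₂⊑T = proj₁ (proj₂ subtree₂)
    j₀   = proj₁ (vertCov D₂ _ (proj₂ (proj₁ (proj₂ (proj₂ subtree₂)))))
    open TreeAnchor tree subtree₁ T₂⊑T cover D₁ D₂
    open Glue (proj₁ tree) (proj₁ (proj₂ subtree₁)) T₂⊑T cover D₁ D₂ j₀ anchor
              (Attachment.subtree-edge tree subtree₁ (vertex? D₁)) anchor-edge anchor-bag
    rearrange : ∀ a b → a + suc b + 1 ≡ (a + 1) + (b + 1)
    rearrange = solve-∀
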